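{- Let $F$ be a finite directed graph and $v$ a vertex of $F$. For $i\ge1$ let $F_i$ be the directed graph obtained from $F$ by replacing $v$ by a clique on $i$ new vertices $v_1,\ldots,v_i$, where each edge $\langle v,w\rangle$ (resp. $\langle z,v\rangle$) of $F$ is replaced by the $i$ edges $\langle v_j,w\rangle$ (resp. $\langle z,v_j\rangle$), $j=1,\ldots,i$. If $1\le k<r$ are natural numbers, then $F_k$ and $F_r$ satisfy exactly the same sentences of $L^{\omega}_{\infty\omega}$ having at most $k$ distinct variables.
   Context: $L^{\omega}_{\infty\omega}$ is the extension of first-order logic (over a finite relational vocabulary) allowing conjunctions and disjunctions of arbitrary sets of formulas, provided the total number of distinct individual variables, free or bound, occurring in the resulting formula is finite. $L^k_{\infty\omega}$ denotes the formulas of $L^\omega_{\infty\omega}$ using at most the $k$ variables $x_1,\ldots,x_k$. -}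

module Defs where

open import Data.Nat using (ℕ)
open import Data.Fin using (Fin; _≟_)
open import Data.Product using (Σ; _×_; _,_)
open import Data.Sum using (_⊎_; inj₁; inj₂)
open import Data.Empty using (⊥)
open import Relation.Nullary using (¬_; yes; no)
open import Relation.Binary.PropositionalEquality using (_≡_; _≢_)

record Digraph : Set₁ where
  field
    n : ℕ
    E : Fin n → Fin n → Set
open Digraph public

record Structure : Set₁ where
  field
    Carrier : Set
    Rel     : Carrier → Carrier → Set
open Structure public

blowup : (F : Digraph) → Fin (n F) → ℕ → Structure
blowup F v i = record { Carrier = V ; Rel = R }
  where
    V : Set
    V = Σ (Fin (n F)) (λ a → a ≢ v) ⊎ Fin i
    R : V → V → Set
    R (inj₁ (a , _)) (inj₁ (b , _)) = E F a b
    R (inj₁ (a , _)) (inj₂ j)       = E F a v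
    R (inj₂ j)       (inj₁ (b , _)) = E F v b
    -- clique edges between distinct new vertices; if F has a loop ⟨v,v⟩
    -- it is replaced by all edges ⟨v_j,v_l⟩ (including loops)
    R (inj₂ j)       (inj₂ l)       = (j ≢ l) ⊎ E F v v

-- Formulas of L^k_{∞ω} over the vocabulary {E}: variables x_1..x_k are Fin k,
-- conjunctions/disjunctions over arbitrary index sets.
data Formula (k : ℕ) : Set₁ where
  eq   : Fin k → Fin k → Formula k
  rel  : Fin k → Fin k → Formula k
  neg  : Formula k → Formula k
  ⋀    : (I : Set) → (I → Formula k) → Formula k
  ⋁    : (I : Set) → (I → Formula k) → Formula k
  ∃'   : Fin k → Formula k → Formula k
  ∀'   : Fin k → Formula k → Formula k

data Free {k : ℕ} : Formula k → Fin k → Set₁ where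
  eqˡ  : ∀ {x y} → Free (eq x y) x
  eqʳ  : ∀ {x y} → Free (eq x y) y
  relˡ : ∀ {x y} → Free (rel x y) x
  relʳ : ∀ {x y} → Free (rel x y) y
  negF : ∀ {φ z} → Free φ z → Free (neg φ) z
  ⋀F   : ∀ {I f z} (i : I) → Free (f i) z → Free (⋀ I f) z
  ⋁F   : ∀ {I f z} (i : I) → Free (f i) z → Free (⋁ I f) z
  ∃F   : ∀ {x φ z} → z ≢ x → Free φ z → Free (∃' x φ) z
  ∀F   : ∀ {x φ z} → z ≢ x → Free φ z → Free (∀' x φ) z

Sentence : {k : ℕ} → Formula k → Set₁
Sentence {k} φ = (z : Fin k) → ¬ Free φ z

update : {k : ℕ} {A : Set} → (Fin k → A) → Fin k → A → (Fin k → A)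
update a x d z with z ≟ x
... | yes _ = d
... | no  _ = a z

Sat : {k : ℕ} (M : Structure) → Formula k → (Fin k → Carrier M) → Set
Sat M (eq x y)  a = a x ≡ a y
Sat M (rel x y) a = Rel M (a x) (a y)
Sat M (neg φ)   a = ¬ Sat M φ a
Sat M (⋀ I f)   a = (i : I) → Sat M (f i) a
Sat M (⋁ I f)   a = Σ I (λ i → Sat M (f i) a)
Sat M (∃' x φ)  a = Σ (Carrier M) (λ d → Sat M φ (update a x d))
Sat M (∀' x φ)  a = (d : Carrier M) → Sat M φ (update a x d)

_⊨_ : {k : ℕ} → Structure → Formula k → Set
M ⊨ φ = ∀ a → Sat M φ a

-- Call assignments of the k variables into F_i and F_j corresponding if they
-- agree on old vertices, send new vertices to new vertices and satisfy the same
-- equalities between variables. Corresponding assignments satisfy the same atomic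
-- formulas, and for i, j ≥ k they form a back-and-forth system, so they satisfy
-- the same L^k_{∞ω} formulas: a variable moved onto a new vertex occupied by no
-- other variable is matched on the other side by one of the j ≥ k new vertices,
-- at most k - 1 of which are occupied.
module Submission where

open import Defs
open import Data.Nat using (ℕ; suc; _≤_; _<_)
open import Data.Nat.Properties using (≤-refl; <⇒≤)
open import Data.Fin using (Fin; zero; _≟_; inject≤; punchIn; punchOut)
open import Data.Fin.Properties
  using (any?; all?; ¬∀⟶∃¬; <⇒notInjective; inject≤-injective; punchIn-punchOut)
open import Data.Product using (∃-syntax; Σ-syntax; _,_; proj₁; proj₂)
import Data.Product as Product
open import Data.Sum using (inj₁; inj₂)
open import Data.Sum.Properties using (inj₁-injective; inj₂-injective)
open import Data.Sum.Function.Propositional using (_⊎-⇔_)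
open import Data.Empty using (⊥-elim)
open import Function using (_∘_)
open import Function.Bundles using (_⇔_; mk⇔; Equivalence)
open import Function.Definitions using (Injective)
open import Function.Construct.Identity using (⇔-id)
open import Function.Construct.Symmetry using (⇔-sym)
open import Function.Construct.Composition using (_⇔-∘_)
open import Function.Related.TypeIsomorphisms using (¬-cong-⇔)
open import Relation.Nullary using (Dec; yes; no; ¬?)
open import Relation.Nullary.Decidable using (decidable-stable; map′)
open import Relation.Binary.PropositionalEquality
  using (_≡_; _≢_; refl; sym; trans; cong; subst)

open Equivalence using (to; from)

module _ {k : ℕ} (M N : Structure) where

  record BackAndForth (R : (Fin k → Carrier M) → (Fin k → Carrier N) → Set) : Set where
    field
      eq⇔   : ∀ {a b} → R a b → ∀ x y → (a x ≡ a y) ⇔ (b x ≡ b y)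
      rel⇔  : ∀ {a b} → R a b → ∀ x y → Rel M (a x) (a y) ⇔ Rel N (b x) (b y)
      forth : ∀ {a b} → R a b → ∀ x d → ∃[ d′ ] R (update a x d) (update b x d′)
      back  : ∀ {a b} → R a b → ∀ x d′ → ∃[ d ] R (update a x d) (update b x d′)

  module _ {R} (system : BackAndForth R) where
    open BackAndForth system

    Sat-⇔ : ∀ {a b} → R a b → (φ : Formula k) → Sat M φ a ⇔ Sat N φ b
    Sat-⇔ r (eq x y)  = eq⇔ r x y
    Sat-⇔ r (rel x y) = rel⇔ r x y
    Sat-⇔ r (neg φ)   = ¬-cong-⇔ (Sat-⇔ r φ)
    Sat-⇔ r (⋀ I f)   = mk⇔ (λ h i → to (Sat-⇔ r (f i)) (h i))
                            (λ h i → from (Sat-⇔ r (f i)) (h i))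
    Sat-⇔ r (⋁ I f)   = mk⇔ (λ (i , s) → i , to (Sat-⇔ r (f i)) s)
                            (λ (i , s) → i , from (Sat-⇔ r (f i)) s)
    Sat-⇔ r (∃' x φ)  = mk⇔
      (λ (d , s) → let (d′ , r′) = forth r x d in d′ , to (Sat-⇔ r′ φ) s)
      (λ (d′ , s) → let (d , r′) = back r x d′ in d , from (Sat-⇔ r′ φ) s)
    Sat-⇔ r (∀' x φ)  = mk⇔
      (λ h d′ → let (d , r′) = back r x d′ in to (Sat-⇔ r′ φ) (h d))
      (λ h d → let (d′ , r′) = forth r x d in from (Sat-⇔ r′ φ) (h d′))

    ⊨-⇔ : (∀ a → ∃[ b ] R a b) → (∀ b → ∃[ a ] R a b) →
          (φ : Formula k) → (M ⊨ φ) ⇔ (N ⊨ φ)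
    ⊨-⇔ left-total right-total φ = mk⇔
      (λ h b → let (a , r) = right-total b in to (Sat-⇔ r φ) (h a))
      (λ h a → let (b , r) = left-total a in from (Sat-⇔ r φ) (h b))

<⇒missed : ∀ {A : Set} {m j} (ι : Fin j → A) → Injective _≡_ _≡_ ι → m < j →
           (g : Fin m → A) → (∀ y s → Dec (g y ≡ ι s)) → ∃[ s ] ∀ y → g y ≢ ι s
<⇒missed {m = m} ι ι-injective m<j g g≟ι
  with any? (λ s → all? (λ y → ¬? (g≟ι y s)))
... | yes missed = missed
... | no ∄missed = ⊥-elim (<⇒notInjective m<j hit-injective)
  where
    hit : ∀ s → ∃[ y ] g y ≡ ι s
    hit s = Product.map₂ (decidable-stable (g≟ι _ s))
      (¬∀⟶∃¬ m _ (λ y → ¬? (g≟ι y s)) (λ ∀missed → ∄missed (s , ∀missed)))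

    hit-injective : Injective _≡_ _≡_ (proj₁ ∘ hit)
    hit-injective {s} {s′} same =
      ι-injective (trans (sym (proj₂ (hit s))) (trans (cong g same) (proj₂ (hit s′))))

module BlowUp (F : Digraph) (v : Fin (n F)) where

  Vertex : ℕ → Set
  Vertex i = Carrier (blowup F v i)

  _≟inj₂_ : ∀ {i} (e : Vertex i) (t : Fin i) → Dec (e ≡ inj₂ t)
  inj₁ _ ≟inj₂ t = no λ ()
  inj₂ s ≟inj₂ t = map′ (cong inj₂) inj₂-injective (s ≟ t)

  data SameOrigin {i j} : Vertex i → Vertex j → Set where
    old : ∀ p → SameOrigin (inj₁ p) (inj₁ p)
    new : ∀ s t → SameOrigin (inj₂ s) (inj₂ t)

  SameOrigin-sym : ∀ {i j} {e : Vertex i} {f : Vertex j} → SameOrigin e f → SameOrigin f e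
  SameOrigin-sym (old p)   = old p
  SameOrigin-sym (new s t) = new t s

  Rel-⇔ : ∀ {i j} {e₁ e₂ : Vertex i} {f₁ f₂ : Vertex j} →
          SameOrigin e₁ f₁ → SameOrigin e₂ f₂ → (e₁ ≡ e₂) ⇔ (f₁ ≡ f₂) →
          Rel (blowup F v i) e₁ e₂ ⇔ Rel (blowup F v j) f₁ f₂
  Rel-⇔ (old _)   (old _)   _ = ⇔-id _
  Rel-⇔ (old _)   (new _ _) _ = ⇔-id _
  Rel-⇔ (new _ _) (old _)   _ = ⇔-id _
  Rel-⇔ {i} {j} (new _ _) (new _ _) same⇔same =
    ¬-cong-⇔ (⇔-sym (inj₂-≡⇔ j) ⇔-∘ (same⇔same ⇔-∘ inj₂-≡⇔ i)) ⊎-⇔ ⇔-id _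
    where
      inj₂-≡⇔ : ∀ l {s t : Fin l} → (s ≡ t) ⇔ (_≡_ {A = Vertex l} (inj₂ s) (inj₂ t))
      inj₂-≡⇔ _ = mk⇔ (cong inj₂) inj₂-injective

  record Corresponds {k i j} (a : Fin k → Vertex i) (b : Fin k → Vertex j) : Set where
    field
      sameOrigin : ∀ x → SameOrigin (a x) (b x)
      ≡⇔≡        : ∀ x y → (a x ≡ a y) ⇔ (b x ≡ b y)
  open Corresponds

  module _ {k i j : ℕ} {a : Fin k → Vertex i} {b : Fin k → Vertex j} where

    Corresponds-sym : Corresponds a b → Corresponds b a
    Corresponds-sym c = record
      { sameOrigin = SameOrigin-sym ∘ sameOrigin c
      ; ≡⇔≡        = λ x y → ⇔-sym (≡⇔≡ c x y)
      }

    Corresponds-update : Corresponds a b → ∀ x {d d′} → SameOrigin d d′ →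
      (∀ y → y ≢ x → (d ≡ a y) ⇔ (d′ ≡ b y)) →
      Corresponds (update a x d) (update b x d′)
    Corresponds-update c x {d} {d′} d~d′ d⇔d′ = record
      { sameOrigin = sameOrigin′ ; ≡⇔≡ = ≡⇔≡′ }
      where
        sameOrigin′ : ∀ z → SameOrigin (update a x d z) (update b x d′ z)
        sameOrigin′ z with z ≟ x
        ... | yes _ = d~d′
        ... | no  _ = sameOrigin c z

        ≡⇔≡′ : ∀ z w →
               (update a x d z ≡ update a x d w) ⇔ (update b x d′ z ≡ update b x d′ w)
        ≡⇔≡′ z w with z ≟ x | w ≟ x
        ... | yes _  | yes _   = mk⇔ (λ _ → refl) (λ _ → refl)
        ... | yes _  | no  w≢x = d⇔d′ w w≢x
        ... | no z≢x | yes _   = mk⇔ sym sym ⇔-∘ (d⇔d′ z z≢x ⇔-∘ mk⇔ sym sym)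
        ... | no  _  | no  _   = ≡⇔≡ c z w

    Corresponds-copy : Corresponds a b → ∀ x y →
      Corresponds (update a x (a y)) (update b x (b y))
    Corresponds-copy c x y = Corresponds-update c x (sameOrigin c y) (λ z _ → ≡⇔≡ c y z)

  freshNew : ∀ {k j} → k ≤ j → (b : Fin k → Vertex j) (x : Fin k) →
             ∃[ s ] ∀ y → y ≢ x → b y ≢ inj₂ s
  freshNew {suc _} k≤j b x
    with <⇒missed inj₂ inj₂-injective k≤j (b ∘ punchIn x) (λ y → b (punchIn x y) ≟inj₂_)
  ... | s , missed = s , λ y y≢x →
    subst (λ z → b z ≢ inj₂ s) (punchIn-punchOut (y≢x ∘ sym)) (missed (punchOut (y≢x ∘ sym)))

  Corresponds-forth : ∀ {k i j} {a : Fin k → Vertex i} {b : Fin k → Vertex j} → k ≤ j →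
    Corresponds a b → ∀ x d → ∃[ d′ ] Corresponds (update a x d) (update b x d′)
  Corresponds-forth _ c x (inj₁ p) =
    inj₁ p , Corresponds-update c x (old p) (λ y _ → old-≡⇔ (sameOrigin c y))
    where
      old-≡⇔ : ∀ {i j} {e : Vertex i} {f : Vertex j} →
               SameOrigin e f → (inj₁ p ≡ e) ⇔ (inj₁ p ≡ f)
      old-≡⇔ (old _)   = mk⇔ (cong inj₁ ∘ inj₁-injective) (cong inj₁ ∘ inj₁-injective)
      old-≡⇔ (new _ _) = mk⇔ (λ ()) (λ ())
  Corresponds-forth {a = a} {b} k≤j c x (inj₂ t) with any? (λ y → a y ≟inj₂ t)
  ... | yes (y , ay≡t) =
    b y , subst (λ d → Corresponds (update a x d) (update b x (b y))) ay≡t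
                (Corresponds-copy c x y)
  ... | no t∉a =
    let (s , s∉b) = freshNew k≤j b x
    in inj₂ s , Corresponds-update c x (new t s) λ y y≢x →
         mk⇔ (λ t≡ay → ⊥-elim (t∉a (y , sym t≡ay)))
             (λ s≡by → ⊥-elim (s∉b y y≢x (sym s≡by)))

  Corresponds-backAndForth : ∀ {k i j} → k ≤ i → k ≤ j →
    BackAndForth (blowup F v i) (blowup F v j) (Corresponds {k} {i} {j})
  Corresponds-backAndForth k≤i k≤j = record
    { eq⇔   = ≡⇔≡
    ; rel⇔  = λ c x y → Rel-⇔ (sameOrigin c x) (sameOrigin c y) (≡⇔≡ c x y)
    ; forth = Corresponds-forth k≤j
    ; back  = λ c x d′ →
        Product.map₂ Corresponds-sym (Corresponds-forth k≤i (Corresponds-sym c) x d′)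
    }

  corresponding : ∀ {k i j} → k ≤ j → (a : Fin k → Vertex i) →
    Σ[ b ∈ (Fin k → Vertex j) ] Corresponds a b
  corresponding {ℕ.zero} _ a = (λ ()) , record { sameOrigin = λ () ; ≡⇔≡ = λ () }
  corresponding {suc _} {i} {j} k≤j a = rename ∘ a , record
    { sameOrigin = sameOrigin-rename ∘ a
    ; ≡⇔≡        = λ x y → mk⇔ (cong rename) (rename-injective x y)
    }
    where
      -- A new vertex is renamed after a variable lying on it; this embeds the
      -- occupied new vertices into Fin k ⊆ Fin j (zero is junk for unoccupied ones).
      holder : Fin i → Fin _
      holder t with any? (λ y → a y ≟inj₂ t)
      ... | yes (y , _) = y
      ... | no  _       = zero

      holder-holds : ∀ {y t} → a y ≡ inj₂ t → a (holder t) ≡ inj₂ t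
      holder-holds {y} {t} ay≡t with any? (λ y → a y ≟inj₂ t)
      ... | yes (_ , held) = held
      ... | no  unheld     = ⊥-elim (unheld (y , ay≡t))

      rename : Vertex i → Vertex j
      rename (inj₁ p) = inj₁ p
      rename (inj₂ t) = inj₂ (inject≤ (holder t) k≤j)

      sameOrigin-rename : ∀ e → SameOrigin e (rename e)
      sameOrigin-rename (inj₁ p) = old p
      sameOrigin-rename (inj₂ t) = new t _

      rename-injective : ∀ x y → rename (a x) ≡ rename (a y) → a x ≡ a y
      rename-injective x y with a x in ax | a y in ay
      ... | inj₁ _ | inj₁ _ = λ { refl → refl }
      ... | inj₁ _ | inj₂ _ = λ ()
      ... | inj₂ _ | inj₁ _ = λ ()
      ... | inj₂ _ | inj₂ _ = λ same →
        trans (sym (holder-holds ax))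
          (trans (cong a (inject≤-injective k≤j k≤j _ _ (inj₂-injective same))) (holder-holds ay))

lemma3p3 : (F : Digraph) (v : Fin (Digraph.n F)) (k r : ℕ) → 1 ≤ k → k < r →
    (φ : Formula k) → Sentence φ →
    (blowup F v k ⊨ φ) ⇔ (blowup F v r ⊨ φ)
lemma3p3 F v k r _ k<r φ _ =
  ⊨-⇔ _ _ (Corresponds-backAndForth ≤-refl k≤r) (corresponding k≤r)
    (λ b → Product.map₂ Corresponds-sym (corresponding ≤-refl b)) φ
  where
    open BlowUp F v
    k≤r : k ≤ r
    k≤r = <⇒≤ k<r
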